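{- Let $G_1$ and $G_2$ be connected graphs with $\gamma(G_1)\le \gamma(G_2)$. Then $\gamma(G_1\vee G_2)=1$ if $\gamma(G_1)=1$, and $\gamma(G_1\vee G_2)=2$ if $\gamma(G_1)\ge 2$. Moreover: (a) if $\gamma(G_1)=\gamma(G_2)=1$, then $\zeta(G_1\vee G_2)=\zeta(G_1)+\zeta(G_2)$; (b) if $\gamma(G_1)=\gamma(G_2)=2$, then $\zeta(G_1\vee G_2)=\zeta(G_1)+\zeta(G_2)+|V(G_1)|\cdot|V(G_2)|$; (c) if $\gamma(G_1)=1<\gamma(G_2)$, then $\zeta(G_1\vee G_2)=\zeta(G_1)$; (d) if $\gamma(G_1)=2<\gamma(G_2)$, then $\zeta(G_1\vee G_2)=\zeta(G_1)+|V(G_1)|\cdot|V(G_2)|$; (e) if $2<\gamma(G_1)\le\gamma(G_2)$, then $\zeta(G_1\vee G_2)=|V(G_1)|\cdot|V(G_2)|$.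
   Context: All graphs are finite and simple. For a graph $G=(V,E)$, a set $S\subseteq V$ is a dominating set if every vertex of $V\setminus S$ is adjacent to some vertex of $S$. The domination number $\gamma(G)$ is the minimum cardinality of a dominating set; a dominating set of cardinality $\gamma(G)$ is called a $\gamma$-set. The dominion $\zeta(G)$ is the number of $\gamma$-sets of $G$. The join $G_1\vee G_2$ is the graph obtained from the disjoint union of $G_1$ and $G_2$ by adding all edges between $V(G_1)$ and $V(G_2)$. -}

module Defs where

open import Data.Bool using (Bool; true; false)
open import Data.Nat using (ℕ; zero; suc; _+_; _⊓_; _<_)
open import Data.Nat.Properties using (_≟_)
open import Data.Fin using (Fin; splitAt)
open import Data.Fin.Subset using (Subset; inside; outside; _∈_; ∣_∣)
open import Data.Fin.Subset.Properties using (_∈?_)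
open import Data.Fin.Properties using (all?; any?)
open import Data.Vec using ([]; _∷_)
open import Data.List using (List; []; _∷_; _++_; map; filter; foldr; length)
open import Data.Sum using (_⊎_; inj₁; inj₂)
open import Data.Sum.Relation.Unary.All using () 
open import Data.Product using (Σ; ∃; _×_; _,_)
open import Relation.Nullary using (Dec; ¬_)
open import Relation.Nullary.Decidable using (_⊎-dec_; _×-dec_)
open import Relation.Binary.PropositionalEquality using (_≡_; refl)
import Data.Bool.Properties as BP

record Graph : Set where
  field
    n     : ℕ
    adj   : Fin n → Fin n → Bool
    sym   : ∀ u v → adj u v ≡ adj v u
    irrefl : ∀ v → adj v v ≡ false
open Graph public

order : Graph → ℕ
order G = n G

Adj : (G : Graph) → Fin (n G) → Fin (n G) → Set
Adj G u v = adj G u v ≡ true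

data Reach (G : Graph) : Fin (n G) → Fin (n G) → Set where
  here : ∀ {u} → Reach G u u
  step : ∀ {u w v} → Adj G u w → Reach G w v → Reach G u v

Connected : Graph → Set
Connected G = (0 < n G) × (∀ u v → Reach G u v)

Dominating : (G : Graph) → Subset (n G) → Set
Dominating G S = ∀ v → v ∈ S ⊎ (∃ λ u → u ∈ S × Adj G u v)

dominating? : (G : Graph) → (S : Subset (n G)) → Dec (Dominating G S)
dominating? G S = all? λ v → (v ∈? S) ⊎-dec any? (λ u → (u ∈? S) ×-dec (adj G u v BP.≟ true))

subsets : (k : ℕ) → List (Subset k)
subsets zero = [] ∷ []
subsets (suc k) = map (inside ∷_) (subsets k) ++ map (outside ∷_) (subsets k)

-- domination number: minimum cardinality of a dominating set
-- (V itself dominates, so n is an upper bound used as the fold seed)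
γ : Graph → ℕ
γ G = foldr _⊓_ (n G) (map ∣_∣ (filter (dominating? G) (subsets (n G))))

IsγSet : (G : Graph) → Subset (n G) → Set
IsγSet G S = Dominating G S × (∣ S ∣ ≡ γ G)

ζ : Graph → ℕ
ζ G = length (filter (λ S → dominating? G S ×-dec (∣ S ∣ ≟ γ G)) (subsets (n G)))

module _ {n₁ n₂ : ℕ} (a₁ : Fin n₁ → Fin n₁ → Bool) (a₂ : Fin n₂ → Fin n₂ → Bool) where
  sumAdj : Fin n₁ ⊎ Fin n₂ → Fin n₁ ⊎ Fin n₂ → Bool
  sumAdj (inj₁ x) (inj₁ y) = a₁ x y
  sumAdj (inj₂ x) (inj₂ y) = a₂ x y
  sumAdj (inj₁ _) (inj₂ _) = true
  sumAdj (inj₂ _) (inj₁ _) = true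

_∨_ : Graph → Graph → Graph
G₁ ∨ G₂ = record
  { n = n G₁ + n G₂
  ; adj = λ u v → sumAdj (adj G₁) (adj G₂) (splitAt (n G₁) u) (splitAt (n G₁) v)
  ; sym = λ u v → symS (splitAt (n G₁) u) (splitAt (n G₁) v)
  ; irrefl = λ v → irrS (splitAt (n G₁) v)
  }
  where
  symS : ∀ x y → sumAdj (adj G₁) (adj G₂) x y ≡ sumAdj (adj G₁) (adj G₂) y x
  symS (inj₁ x) (inj₁ y) = sym G₁ x y
  symS (inj₂ x) (inj₂ y) = sym G₂ x y
  symS (inj₁ _) (inj₂ _) = refl
  symS (inj₂ _) (inj₁ _) = refl
  irrS : ∀ x → sumAdj (adj G₁) (adj G₂) x x ≡ false
  irrS (inj₁ x) = irrefl G₁ x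
  irrS (inj₂ x) = irrefl G₂ x

-- Write a vertex set S of G₁ ∨ G₂ as A ∪ B with A ⊆ V(G₁) and B ⊆ V(G₂). As every vertex of
-- one side is adjacent to every vertex of the other, S dominates the join iff (A dominates G₁
-- or B ≠ ∅) and (B dominates G₂ or A ≠ ∅). So for k ≥ 1 the dominating k-sets of the join are
-- the dominating k-sets of G₁, those of G₂, and the k-sets meeting both sides; there are no
-- such sets for k = 1 and |V(G₁)|·|V(G₂)| of them for k = 2. As γ is the least k admitting a
-- dominating k-set, and a nonempty graph has no dominating 0-set, these counts determine
-- γ(G₁ ∨ G₂), and ζ(G₁ ∨ G₂) is the count at that k. Connectivity is used only through
-- non-emptiness.

{-# OPTIONS --safe #-}
module Submission where

open import Defs hiding (sym)
open import Data.Nat using (ℕ; zero; suc; _+_; _*_; _≤_; _<_; z≤n; s≤s)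
open import Data.Nat.Properties
  using ( _≟_; suc-injective; n>0⇒n≢0; ≤-reflexive; ≤-trans; ≤-antisym; <⇒≤; <⇒≱; ≮⇒≥
        ; <-irrefl; <-≤-trans; m≤m+n; m≤n+m; ⊓-sel; m≤n⇒m⊓o≤n; m≤n⇒o⊓m≤n
        ; +-suc; +-assoc; +-identityʳ; +-mono-≤; *-identityˡ; *-identityʳ; *-distribʳ-+; *-mono-<
        ; module ≤-Reasoning )
open import Data.Nat.Combinatorics using (_C_; nC1≡n; nCk+nC[k+1]≡[n+1]C[k+1])
open import Data.Bool using (Bool; true; false)
open import Data.Fin using (Fin; zero; suc; _↑ˡ_; _↑ʳ_; fromℕ<)
open import Data.Fin.Properties using (splitAt-↑ˡ; splitAt-↑ʳ)
open import Data.Fin.Subset using (Subset; inside; outside; _∈_; ∣_∣; Nonempty; ⊤)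
open import Data.Fin.Subset.Properties
  using (nonempty?; Empty-unique; ∣⊥∣≡0; ∣p∣≤∣x∷p∣; ∈⊤; ∣⊤∣≡n)
open import Data.Vec using ([]; _∷_; take; drop; here; there)
open import Data.List using (List; []; _∷_; _++_; map; filter; length)
open import Data.List.Properties
  using (length-++; filter-++; filter-≐; filter-none; filter-some; foldr-preservesᵒ)
open import Data.List.Membership.Propositional using (lose) renaming (_∈_ to _∈ᴸ_)
open import Data.List.Membership.Propositional.Properties
  using (∈-map⁺; ∈-map⁻; ∈-++⁺ˡ; ∈-++⁺ʳ; ∈-filter⁺; ∈-filter⁻; foldr-selective)
open import Data.List.Relation.Unary.All using (universal)
import Data.List.Relation.Unary.Any as Any
open Any using (here)
open import Data.Empty using (⊥-elim)
open import Data.Product using (_×_; _,_; ∃; proj₂)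
open import Data.Sum using (_⊎_; inj₁; inj₂; [_,_]′)
import Data.Sum as Sum
open import Function using (_∘_; _$_; _⇔_; mk⇔; Equivalence)
open import Level using (Level; 0ℓ; _⊔_)
open import Relation.Nullary using (¬_; Dec; yes; no; does; contradiction)
open import Relation.Nullary.Decidable using (_×-dec_)
open import Relation.Unary
  using (Pred; Decidable; _⊆_; _≐_; _∪_; _∩_; _⊥_; Empty; Satisfiable)
open import Relation.Unary.Properties using (_∪?_; _∩?_)
open import Relation.Binary.PropositionalEquality
  using (_≡_; refl; sym; trans; cong; cong₂; subst; module ≡-Reasoning)

private
  variable
    ℓ p q : Level
    X Y : Set ℓ

count : {P : Pred X p} → Decidable P → List X → ℕ
count P? xs = length (filter P? xs)

module _ {P : Pred X p} (P? : Decidable P) where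

  count-++ : ∀ xs ys → count P? (xs ++ ys) ≡ count P? xs + count P? ys
  count-++ xs ys = trans (cong length (filter-++ P? xs ys)) (length-++ (filter P? xs))

  count-map : (f : Y → X) → ∀ xs → count P? (map f xs) ≡ count (P? ∘ f) xs
  count-map f [] = refl
  count-map f (x ∷ xs) with does (P? (f x))
  ... | true  = cong suc (count-map f xs)
  ... | false = count-map f xs

  Empty⇒count≡0 : Empty P → ∀ xs → count P? xs ≡ 0
  Empty⇒count≡0 ∅ xs = cong length (filter-none P? (universal ∅ xs))

  count>0 : ∀ {x xs} → x ∈ᴸ xs → P x → 0 < count P? xs
  count>0 x∈xs px = filter-some P? (lose x∈xs px)

  count>0⇒Satisfiable : ∀ xs → 0 < count P? xs → Satisfiable P
  count>0⇒Satisfiable (x ∷ xs) pos with P? x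
  ... | yes px = x , px
  ... | no  _  = count>0⇒Satisfiable xs pos

module _ {P : Pred X p} {Q : Pred X q} (P? : Decidable P) (Q? : Decidable Q) where

  count-≐ : P ≐ Q → ∀ xs → count P? xs ≡ count Q? xs
  count-≐ P≐Q xs = cong length (filter-≐ P? Q? P≐Q xs)

  count-∪ : P ⊥ Q → ∀ xs → count (P? ∪? Q?) xs ≡ count P? xs + count Q? xs
  count-∪ P⊥Q [] = refl
  count-∪ P⊥Q (x ∷ xs) with P? x | Q? x
  ... | yes px | yes qx = ⊥-elim (P⊥Q (px , qx))
  ... | yes _  | no  _  = cong suc (count-∪ P⊥Q xs)
  ... | no  _  | yes _  = trans (cong suc (count-∪ P⊥Q xs)) (sym (+-suc _ _))
  ... | no  _  | no  _  = count-∪ P⊥Q xs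

∈-subsets : ∀ {m} (S : Subset m) → S ∈ᴸ subsets m
∈-subsets []            = here refl
∈-subsets (inside ∷ S)  = ∈-++⁺ˡ (∈-map⁺ (inside ∷_) (∈-subsets S))
∈-subsets (outside ∷ S) =
  ∈-++⁺ʳ (map (inside ∷_) (subsets _)) (∈-map⁺ (outside ∷_) (∈-subsets S))

count-subsets-suc : ∀ m {P : Pred (Subset (suc m)) p} (P? : Decidable P) →
  count P? (subsets (suc m)) ≡
  count (P? ∘ (inside ∷_)) (subsets m) + count (P? ∘ (outside ∷_)) (subsets m)
count-subsets-suc m P? = trans (count-++ P? (map (inside ∷_) (subsets m)) _)
  (cong₂ _+_ (count-map P? (inside ∷_) (subsets m)) (count-map P? (outside ∷_) (subsets m)))

OfSize : ∀ {m} → ℕ → Pred (Subset m) 0ℓ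
OfSize r S = ∣ S ∣ ≡ r

ofSize? : ∀ {m} r → Decidable (OfSize {m} r)
ofSize? r S = ∣ S ∣ ≟ r

count-ofSize : ∀ m r → count (ofSize? r) (subsets m) ≡ m C r
count-ofSize zero    zero    = refl
count-ofSize zero    (suc r) = refl
count-ofSize (suc m) zero    =
  trans (count-subsets-suc m (ofSize? 0))
    (cong₂ _+_ (Empty⇒count≡0 (ofSize? 0 ∘ (inside ∷_)) (λ _ ()) (subsets m)) (count-ofSize m 0))
count-ofSize (suc m) (suc r) = begin
  count (ofSize? (suc r)) (subsets (suc m))
    ≡⟨ count-subsets-suc m (ofSize? (suc r)) ⟩
  count (ofSize? (suc r) ∘ (inside ∷_)) (subsets m) + c
    ≡⟨ cong (_+ c) (count-≐ _ (ofSize? r) (suc-injective , cong suc) (subsets m)) ⟩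
  count (ofSize? r) (subsets m) + c
    ≡⟨ cong₂ _+_ (count-ofSize m r) (count-ofSize m (suc r)) ⟩
  m C r + m C suc r
    ≡⟨ nCk+nC[k+1]≡[n+1]C[k+1] m r ⟩
  suc m C suc r ∎
  where
  open ≡-Reasoning
  c : ℕ
  c = count (ofSize? (suc r)) (subsets m)

∣S∣≡∣take∣+∣drop∣ : ∀ m {k} (S : Subset (m + k)) → ∣ S ∣ ≡ ∣ take m S ∣ + ∣ drop m S ∣
∣S∣≡∣take∣+∣drop∣ zero    S             = refl
∣S∣≡∣take∣+∣drop∣ (suc m) (inside ∷ S)  = cong suc (∣S∣≡∣take∣+∣drop∣ m S)
∣S∣≡∣take∣+∣drop∣ (suc m) (outside ∷ S) = ∣S∣≡∣take∣+∣drop∣ m S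

∣take∣≡∣S∣ : ∀ m {k} (S : Subset (m + k)) → ∣ drop m S ∣ ≡ 0 → ∣ take m S ∣ ≡ ∣ S ∣
∣take∣≡∣S∣ m S ∣drop∣≡0 = sym (begin
  ∣ S ∣                         ≡⟨ ∣S∣≡∣take∣+∣drop∣ m S ⟩
  ∣ take m S ∣ + ∣ drop m S ∣  ≡⟨ cong (∣ take m S ∣ +_) ∣drop∣≡0 ⟩
  ∣ take m S ∣ + 0              ≡⟨ +-identityʳ ∣ take m S ∣ ⟩
  ∣ take m S ∣                  ∎)
  where open ≡-Reasoning

∣drop∣≡∣S∣ : ∀ m {k} (S : Subset (m + k)) → ∣ take m S ∣ ≡ 0 → ∣ drop m S ∣ ≡ ∣ S ∣
∣drop∣≡∣S∣ m S ∣take∣≡0 =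
  sym (trans (∣S∣≡∣take∣+∣drop∣ m S) (cong (_+ ∣ drop m S ∣) ∣take∣≡0))

_⊠_ : ∀ {m k} → Pred (Subset m) p → Pred (Subset k) q → Pred (Subset (m + k)) (p ⊔ q)
_⊠_ {m = m} P Q S = P (take m S) × Q (drop m S)

_⊠?_ : ∀ {m k} {P : Pred (Subset m) p} {Q : Pred (Subset k) q} →
  Decidable P → Decidable Q → Decidable (P ⊠ Q)
_⊠?_ {m = m} P? Q? S = P? (take m S) ×-dec Q? (drop m S)

count-⊠ : ∀ m {k} {P : Pred (Subset m) p} {Q : Pred (Subset k) q}
  (P? : Decidable P) (Q? : Decidable Q) →
  count (P? ⊠? Q?) (subsets (m + k)) ≡ count P? (subsets m) * count Q? (subsets k)
count-⊠ zero {k} P? Q? with P? []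
... | yes P[] = trans (count-≐ _ Q? ((λ (_ , q) → q) , (P[] ,_)) (subsets k)) (sym (+-identityʳ _))
... | no ¬P[] = Empty⇒count≡0 _ (λ _ (P[] , _) → ¬P[] P[]) (subsets k)
count-⊠ (suc m) {k} P? Q? = begin
  count (P? ⊠? Q?) (subsets (suc m + k))
    ≡⟨ count-subsets-suc (m + k) (P? ⊠? Q?) ⟩
  count ((P? ∘ (inside ∷_)) ⊠? Q?) (subsets (m + k)) +
  count ((P? ∘ (outside ∷_)) ⊠? Q?) (subsets (m + k))
    ≡⟨ cong₂ _+_ (count-⊠ m (P? ∘ (inside ∷_)) Q?) (count-⊠ m (P? ∘ (outside ∷_)) Q?) ⟩
  a * c + b * c
    ≡⟨ *-distribʳ-+ c a b ⟨
  (a + b) * c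
    ≡⟨ cong (_* c) (count-subsets-suc m P?) ⟨
  count P? (subsets (suc m)) * c ∎
  where
  open ≡-Reasoning
  a b c : ℕ
  a = count (P? ∘ (inside ∷_)) (subsets m)
  b = count (P? ∘ (outside ∷_)) (subsets m)
  c = count Q? (subsets k)

Nonempty⇒∣p∣>0 : ∀ {m} {S : Subset m} → Nonempty S → 0 < ∣ S ∣
Nonempty⇒∣p∣>0             (zero  , here)    = s≤s z≤n
Nonempty⇒∣p∣>0 {S = x ∷ S} (suc i , there p) =
  ≤-trans (Nonempty⇒∣p∣>0 (i , p)) (∣p∣≤∣x∷p∣ x S)

Empty⇒∣p∣≡0 : ∀ {m} {S : Subset m} → ¬ Nonempty S → ∣ S ∣ ≡ 0
Empty⇒∣p∣≡0 {m} ¬ne = trans (cong ∣_∣ (Empty-unique ¬ne)) (∣⊥∣≡0 m)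

∣p∣>0⇒Nonempty : ∀ {m} {S : Subset m} → 0 < ∣ S ∣ → Nonempty S
∣p∣>0⇒Nonempty {S = S} ∣S∣>0 with nonempty? S
... | yes ne = ne
... | no ¬ne = contradiction (Empty⇒∣p∣≡0 ¬ne) (n>0⇒n≢0 ∣S∣>0)

Straddling : ∀ m k → ℕ → Pred (Subset (m + k)) 0ℓ
Straddling m k r = (Nonempty {n = m} ⊠ Nonempty {n = k}) ∩ OfSize r

straddling? : ∀ m k r → Decidable (Straddling m k r)
straddling? m k r = (nonempty? {n = m} ⊠? nonempty? {n = k}) ∩? ofSize? r

m+n≡2⇒m≡1∧n≡1 : ∀ {a b} → 0 < a → 0 < b → a + b ≡ 2 → a ≡ 1 × b ≡ 1
m+n≡2⇒m≡1∧n≡1 {1}                 {1}           _ _ _  = refl , refl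
m+n≡2⇒m≡1∧n≡1 {1}                 {suc (suc _)} _ _ ()
m+n≡2⇒m≡1∧n≡1 {suc (suc zero)}    {suc _}       _ _ ()
m+n≡2⇒m≡1∧n≡1 {suc (suc (suc _))} {suc _}       _ _ ()

count-straddling-1 : ∀ m k → count (straddling? m k 1) (subsets (m + k)) ≡ 0
count-straddling-1 m k = Empty⇒count≡0 (straddling? m k 1) impossible (subsets (m + k))
  where
  impossible : Empty (Straddling m k 1)
  impossible S ((neA , neB) , ∣S∣≡1) = <-irrefl refl (begin-strict
    1                             <⟨ +-mono-≤ (Nonempty⇒∣p∣>0 neA) (Nonempty⇒∣p∣>0 neB) ⟩
    ∣ take m S ∣ + ∣ drop m S ∣  ≡⟨ ∣S∣≡∣take∣+∣drop∣ m S ⟨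
    ∣ S ∣                         ≡⟨ ∣S∣≡1 ⟩
    1                             ∎)
    where open ≤-Reasoning

count-straddling-2 : ∀ m k → count (straddling? m k 2) (subsets (m + k)) ≡ m * k
count-straddling-2 m k = begin
  count (straddling? m k 2) (subsets (m + k))
    ≡⟨ count-≐ _ (ofSize? {m} 1 ⊠? ofSize? {k} 1) (to , from) (subsets (m + k)) ⟩
  count (ofSize? {m} 1 ⊠? ofSize? {k} 1) (subsets (m + k))
    ≡⟨ count-⊠ m (ofSize? 1) (ofSize? 1) ⟩
  count (ofSize? 1) (subsets m) * count (ofSize? 1) (subsets k)
    ≡⟨ cong₂ _*_ (count-ofSize m 1) (count-ofSize k 1) ⟩
  (m C 1) * (k C 1)
    ≡⟨ cong₂ _*_ (nC1≡n m) (nC1≡n k) ⟩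
  m * k ∎
  where
  open ≡-Reasoning
  to : Straddling m k 2 ⊆ OfSize {m} 1 ⊠ OfSize {k} 1
  to {S} ((neA , neB) , ∣S∣≡2) =
    m+n≡2⇒m≡1∧n≡1 (Nonempty⇒∣p∣>0 neA) (Nonempty⇒∣p∣>0 neB)
                  (trans (sym (∣S∣≡∣take∣+∣drop∣ m S)) ∣S∣≡2)
  from : OfSize {m} 1 ⊠ OfSize {k} 1 ⊆ Straddling m k 2
  from {S} (∣A∣≡1 , ∣B∣≡1) =
    ( ∣p∣>0⇒Nonempty {S = take m S} (≤-reflexive (sym ∣A∣≡1))
    , ∣p∣>0⇒Nonempty {S = drop m S} (≤-reflexive (sym ∣B∣≡1)) ) ,
    trans (∣S∣≡∣take∣+∣drop∣ m S) (cong₂ _+_ ∣A∣≡1 ∣B∣≡1)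

↑ˡ∈⇒∈take : ∀ m {k} {S : Subset (m + k)} {i : Fin m} → i ↑ˡ k ∈ S → i ∈ take m S
↑ˡ∈⇒∈take (suc m) {S = _ ∷ _} {zero}  here      = here
↑ˡ∈⇒∈take (suc m) {S = _ ∷ _} {suc i} (there p) = there (↑ˡ∈⇒∈take m p)

∈take⇒↑ˡ∈ : ∀ m {k} {S : Subset (m + k)} {i : Fin m} → i ∈ take m S → i ↑ˡ k ∈ S
∈take⇒↑ˡ∈ (suc m) {S = _ ∷ _} {zero}  here      = here
∈take⇒↑ˡ∈ (suc m) {S = _ ∷ _} {suc i} (there p) = there (∈take⇒↑ˡ∈ m p)

↑ʳ∈⇒∈drop : ∀ m {k} {S : Subset (m + k)} {j : Fin k} → m ↑ʳ j ∈ S → j ∈ drop m S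
↑ʳ∈⇒∈drop zero    p                     = p
↑ʳ∈⇒∈drop (suc m) {S = _ ∷ _} (there p) = ↑ʳ∈⇒∈drop m p

∈drop⇒↑ʳ∈ : ∀ m {k} {S : Subset (m + k)} {j : Fin k} → j ∈ drop m S → m ↑ʳ j ∈ S
∈drop⇒↑ʳ∈ zero    p               = p
∈drop⇒↑ʳ∈ (suc m) {S = _ ∷ _} p = there (∈drop⇒↑ʳ∈ m p)

data SplitView (m k : ℕ) : Fin (m + k) → Set where
  inl : (i : Fin m) → SplitView m k (i ↑ˡ k)
  inr : (j : Fin k) → SplitView m k (m ↑ʳ j)

splitView : ∀ m {k} (v : Fin (m + k)) → SplitView m k v
splitView zero    j       = inr j
splitView (suc m) zero    = inl zero
splitView (suc m) (suc v) with splitView m v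
... | inl i = inl (suc i)
... | inr j = inr j

∀⊎-const : ∀ {I : Set ℓ} {P : I → Set p} {Q : Set q} →
  Dec Q → (∀ x → P x ⊎ Q) → (∀ x → P x) ⊎ Q
∀⊎-const (yes q) _ = inj₂ q
∀⊎-const (no ¬q) f = inj₁ λ x → Sum.fromInj₁ (⊥-elim ∘ ¬q) (f x)

Dominates : (G : Graph) → Subset (n G) → Fin (n G) → Set
Dominates G S v = v ∈ S ⊎ ∃ λ u → u ∈ S × Adj G u v

dominating⇒Nonempty : ∀ G {S} → Fin (n G) → Dominating G S → Nonempty S
dominating⇒Nonempty G v D with D v
... | inj₁ v∈S           = v , v∈S
... | inj₂ (u , u∈S , _) = u , u∈S

γ-minimal : ∀ G {S} → Dominating G S → γ G ≤ ∣ S ∣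
γ-minimal G {S} D = foldr-preservesᵒ (λ x y → [ m≤n⇒m⊓o≤n y , m≤n⇒o⊓m≤n x ]′) (n G) _
  (inj₂ (Any.map (≤-reflexive ∘ sym) (∈-map⁺ ∣_∣ (∈-filter⁺ (dominating? G) (∈-subsets S) D))))

γ-attained : ∀ G → ∃ (IsγSet G)
γ-attained G with foldr-selective ⊓-sel (n G) (map ∣_∣ (filter (dominating? G) (subsets (n G))))
... | inj₁ γ≡n  = ⊤ , (λ _ → inj₁ ∈⊤) , trans (∣⊤∣≡n (n G)) (sym γ≡n)
... | inj₂ γ∈xs with ∈-map⁻ ∣_∣ γ∈xs
...   | S , S∈dom , γ≡∣S∣ =
  S , proj₂ (∈-filter⁻ (dominating? G) {xs = subsets (n G)} S∈dom) , sym γ≡∣S∣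

DominatingOfSize : (G : Graph) → ℕ → Pred (Subset (n G)) 0ℓ
DominatingOfSize G k = Dominating G ∩ OfSize k

dominatingOfSize? : ∀ G k → Decidable (DominatingOfSize G k)
dominatingOfSize? G k = dominating? G ∩? ofSize? k

-- ζ G is definitionally #dominating G (γ G); the proofs below use this silently.
#dominating : Graph → ℕ → ℕ
#dominating G k = count (dominatingOfSize? G k) (subsets (n G))

ζ>0 : ∀ G → 0 < ζ G
ζ>0 G with γ-attained G
... | S , S-γ = count>0 (dominatingOfSize? G (γ G)) (∈-subsets S) S-γ

#dominating-<γ : ∀ G {k} → k < γ G → #dominating G k ≡ 0
#dominating-<γ G k<γ = Empty⇒count≡0 (dominatingOfSize? G _)
  (λ S (D , ∣S∣≡k) → <⇒≱ k<γ (subst (γ G ≤_) ∣S∣≡k (γ-minimal G D))) (subsets (n G))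

#dominating-0 : ∀ G → 0 < n G → #dominating G 0 ≡ 0
#dominating-0 G n>0 = Empty⇒count≡0 (dominatingOfSize? G 0)
  (λ S (D , ∣S∣≡0) →
    n>0⇒n≢0 (Nonempty⇒∣p∣>0 (dominating⇒Nonempty G (fromℕ< n>0) D)) ∣S∣≡0)
  (subsets (n G))

γ≡least : ∀ G {k} → 0 < #dominating G k → (∀ j → j < k → #dominating G j ≡ 0) → γ G ≡ k
γ≡least G {k} #k>0 #<k≡0 =
  ≤-antisym γ≤k (≮⇒≥ λ γ<k → n>0⇒n≢0 (ζ>0 G) (#<k≡0 (γ G) γ<k))
  where
  γ≤k : γ G ≤ k
  γ≤k with count>0⇒Satisfiable _ (subsets (n G)) #k>0
  ... | S , D , ∣S∣≡k = subst (γ G ≤_) ∣S∣≡k (γ-minimal G D)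

module Join (G₁ G₂ : Graph) where
  private
    n₁ n₂ : ℕ
    n₁ = n G₁
    n₂ = n G₂
    J : Graph
    J = G₁ ∨ G₂
    L : List (Subset (n₁ + n₂))
    L = subsets (n₁ + n₂)
    ⊕ : Fin n₁ ⊎ Fin n₂ → Fin n₁ ⊎ Fin n₂ → Bool
    ⊕ = sumAdj (adj G₁) (adj G₂)

  adj-↑ˡ↑ˡ : ∀ i i′ → adj J (i ↑ˡ n₂) (i′ ↑ˡ n₂) ≡ adj G₁ i i′
  adj-↑ˡ↑ˡ i i′ = cong₂ ⊕ (splitAt-↑ˡ n₁ i n₂) (splitAt-↑ˡ n₁ i′ n₂)

  adj-↑ʳ↑ʳ : ∀ j j′ → adj J (n₁ ↑ʳ j) (n₁ ↑ʳ j′) ≡ adj G₂ j j′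
  adj-↑ʳ↑ʳ j j′ = cong₂ ⊕ (splitAt-↑ʳ n₁ n₂ j) (splitAt-↑ʳ n₁ n₂ j′)

  adj-↑ˡ↑ʳ : ∀ i j → Adj J (i ↑ˡ n₂) (n₁ ↑ʳ j)
  adj-↑ˡ↑ʳ i j = cong₂ ⊕ (splitAt-↑ˡ n₁ i n₂) (splitAt-↑ʳ n₁ n₂ j)

  adj-↑ʳ↑ˡ : ∀ j i → Adj J (n₁ ↑ʳ j) (i ↑ˡ n₂)
  adj-↑ʳ↑ˡ j i = cong₂ ⊕ (splitAt-↑ʳ n₁ n₂ j) (splitAt-↑ˡ n₁ i n₂)

  module _ (S : Subset (n₁ + n₂)) where
    private
      A : Subset n₁
      A = take n₁ S
      B : Subset n₂
      B = drop n₁ S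

    dominates-↑ˡ : ∀ i → Dominates J S (i ↑ˡ n₂) ⇔ (Dominates G₁ A i ⊎ Nonempty B)
    dominates-↑ˡ i = mk⇔ to from
      where
      neighbour : ∀ {u} → SplitView n₁ n₂ u → u ∈ S → Adj J u (i ↑ˡ n₂) →
                  Dominates G₁ A i ⊎ Nonempty B
      neighbour (inl i′) i′∈S e =
        inj₁ (inj₂ (i′ , ↑ˡ∈⇒∈take n₁ i′∈S , trans (sym (adj-↑ˡ↑ˡ i′ i)) e))
      neighbour (inr j)  j∈S  _ = inj₂ (j , ↑ʳ∈⇒∈drop n₁ j∈S)
      to : Dominates J S (i ↑ˡ n₂) → Dominates G₁ A i ⊎ Nonempty B
      to (inj₁ i∈S)           = inj₁ (inj₁ (↑ˡ∈⇒∈take n₁ i∈S))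
      to (inj₂ (u , u∈S , e)) = neighbour (splitView n₁ u) u∈S e
      from : Dominates G₁ A i ⊎ Nonempty B → Dominates J S (i ↑ˡ n₂)
      from (inj₁ (inj₁ i∈A))             = inj₁ (∈take⇒↑ˡ∈ n₁ i∈A)
      from (inj₁ (inj₂ (i′ , i′∈A , e))) =
        inj₂ (i′ ↑ˡ n₂ , ∈take⇒↑ˡ∈ n₁ i′∈A , trans (adj-↑ˡ↑ˡ i′ i) e)
      from (inj₂ (j , j∈B))              =
        inj₂ (n₁ ↑ʳ j , ∈drop⇒↑ʳ∈ n₁ j∈B , adj-↑ʳ↑ˡ j i)

    dominates-↑ʳ : ∀ j → Dominates J S (n₁ ↑ʳ j) ⇔ (Dominates G₂ B j ⊎ Nonempty A)
    dominates-↑ʳ j = mk⇔ to from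
      where
      neighbour : ∀ {u} → SplitView n₁ n₂ u → u ∈ S → Adj J u (n₁ ↑ʳ j) →
                  Dominates G₂ B j ⊎ Nonempty A
      neighbour (inl i)  i∈S  _ = inj₂ (i , ↑ˡ∈⇒∈take n₁ i∈S)
      neighbour (inr j′) j′∈S e =
        inj₁ (inj₂ (j′ , ↑ʳ∈⇒∈drop n₁ j′∈S , trans (sym (adj-↑ʳ↑ʳ j′ j)) e))
      to : Dominates J S (n₁ ↑ʳ j) → Dominates G₂ B j ⊎ Nonempty A
      to (inj₁ j∈S)           = inj₁ (inj₁ (↑ʳ∈⇒∈drop n₁ j∈S))
      to (inj₂ (u , u∈S , e)) = neighbour (splitView n₁ u) u∈S e
      from : Dominates G₂ B j ⊎ Nonempty A → Dominates J S (n₁ ↑ʳ j)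
      from (inj₁ (inj₁ j∈B))             = inj₁ (∈drop⇒↑ʳ∈ n₁ j∈B)
      from (inj₁ (inj₂ (j′ , j′∈B , e))) =
        inj₂ (n₁ ↑ʳ j′ , ∈drop⇒↑ʳ∈ n₁ j′∈B , trans (adj-↑ʳ↑ʳ j′ j) e)
      from (inj₂ (i , i∈A))              =
        inj₂ (i ↑ˡ n₂ , ∈take⇒↑ˡ∈ n₁ i∈A , adj-↑ˡ↑ʳ i j)

    dominating-∨ : Dominating J S ⇔
                   ((Dominating G₁ A ⊎ Nonempty B) × (Dominating G₂ B ⊎ Nonempty A))
    dominating-∨ = mk⇔ to from
      where
      to : Dominating J S → (Dominating G₁ A ⊎ Nonempty B) × (Dominating G₂ B ⊎ Nonempty A)
      to D = ∀⊎-const (nonempty? B) (λ i → Equivalence.to (dominates-↑ˡ i) (D (i ↑ˡ n₂)))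
           , ∀⊎-const (nonempty? A) (λ j → Equivalence.to (dominates-↑ʳ j) (D (n₁ ↑ʳ j)))
      from : (Dominating G₁ A ⊎ Nonempty B) × (Dominating G₂ B ⊎ Nonempty A) → Dominating J S
      from (D₁ , D₂) v = dominates (splitView n₁ v)
        where
        dominates : ∀ {v} → SplitView n₁ n₂ v → Dominates J S v
        dominates (inl i) = Equivalence.from (dominates-↑ˡ i) (Sum.map₁ (_$ i) D₁)
        dominates (inr j) = Equivalence.from (dominates-↑ʳ j) (Sum.map₁ (_$ j) D₂)

  module _ {k} (k>0 : 0 < k) where
    private
      OnlyLeft OnlyRight : Pred (Subset (n₁ + n₂)) 0ℓ
      OnlyLeft  = DominatingOfSize G₁ k ⊠ OfSize 0
      OnlyRight = OfSize 0 ⊠ DominatingOfSize G₂ k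

      onlyLeft? : Decidable OnlyLeft
      onlyLeft? = dominatingOfSize? G₁ k ⊠? ofSize? 0

      onlyRight? : Decidable OnlyRight
      onlyRight? = ofSize? 0 ⊠? dominatingOfSize? G₂ k

      nonempty-of-size-k : ∀ {m} {T : Subset m} → ∣ T ∣ ≡ k → Nonempty T
      nonempty-of-size-k {T = T} ∣T∣≡k = ∣p∣>0⇒Nonempty {S = T} (subst (0 <_) (sym ∣T∣≡k) k>0)

    dominatingOfSize-∨ : DominatingOfSize J k ≐ OnlyLeft ∪ (OnlyRight ∪ Straddling n₁ n₂ k)
    dominatingOfSize-∨ = to , from
      where
      to : DominatingOfSize J k ⊆ OnlyLeft ∪ (OnlyRight ∪ Straddling n₁ n₂ k)
      to {S} (D , ∣S∣≡k)
        with Equivalence.to (dominating-∨ S) D | nonempty? (take n₁ S) | nonempty? (drop n₁ S)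
      ... | _            | yes neA | yes neB = inj₂ (inj₂ ((neA , neB) , ∣S∣≡k))
      ... | inj₁ D₁ , _  | _       | no ¬neB =
        let ∣B∣≡0 = Empty⇒∣p∣≡0 ¬neB
        in  inj₁ ((D₁ , trans (∣take∣≡∣S∣ n₁ S ∣B∣≡0) ∣S∣≡k) , ∣B∣≡0)
      ... | inj₂ neB , _ | _       | no ¬neB = contradiction neB ¬neB
      ... | _ , inj₁ D₂  | no ¬neA | yes _   =
        let ∣A∣≡0 = Empty⇒∣p∣≡0 ¬neA
        in  inj₂ (inj₁ (∣A∣≡0 , (D₂ , trans (∣drop∣≡∣S∣ n₁ S ∣A∣≡0) ∣S∣≡k)))
      ... | _ , inj₂ neA | no ¬neA | yes _   = contradiction neA ¬neA
      from : OnlyLeft ∪ (OnlyRight ∪ Straddling n₁ n₂ k) ⊆ DominatingOfSize J k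
      from {S} (inj₁ ((D₁ , ∣A∣≡k) , ∣B∣≡0)) =
        Equivalence.from (dominating-∨ S) (inj₁ D₁ , inj₂ (nonempty-of-size-k ∣A∣≡k)) ,
        trans (sym (∣take∣≡∣S∣ n₁ S ∣B∣≡0)) ∣A∣≡k
      from {S} (inj₂ (inj₁ (∣A∣≡0 , (D₂ , ∣B∣≡k)))) =
        Equivalence.from (dominating-∨ S) (inj₂ (nonempty-of-size-k ∣B∣≡k) , inj₁ D₂) ,
        trans (sym (∣drop∣≡∣S∣ n₁ S ∣A∣≡0)) ∣B∣≡k
      from {S} (inj₂ (inj₂ ((neA , neB) , ∣S∣≡k))) =
        Equivalence.from (dominating-∨ S) (inj₂ neB , inj₂ neA) , ∣S∣≡k

    #dominating-∨ : #dominating J k ≡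
                    #dominating G₁ k + #dominating G₂ k + count (straddling? n₁ n₂ k) L
    #dominating-∨ = begin
      #dominating J k
        ≡⟨ count-≐ (dominatingOfSize? J k) _ dominatingOfSize-∨ L ⟩
      count (onlyLeft? ∪? (onlyRight? ∪? straddling? n₁ n₂ k)) L
        ≡⟨ count-∪ onlyLeft? _ left⊥right∪straddling L ⟩
      count onlyLeft? L + count (onlyRight? ∪? straddling? n₁ n₂ k) L
        ≡⟨ cong (count onlyLeft? L +_) (count-∪ onlyRight? _ right⊥straddling L) ⟩
      count onlyLeft? L + (count onlyRight? L + c)
        ≡⟨ cong₂ (λ x y → x + (y + c)) (count-⊠ n₁ (dominatingOfSize? G₁ k) (ofSize? 0))
                                       (count-⊠ n₁ (ofSize? 0) (dominatingOfSize? G₂ k)) ⟩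
      #dominating G₁ k * count (ofSize? 0) (subsets n₂) +
      (count (ofSize? 0) (subsets n₁) * #dominating G₂ k + c)
        ≡⟨ cong₂ (λ x y → #dominating G₁ k * x + (y * #dominating G₂ k + c))
                 (count-ofSize n₂ 0) (count-ofSize n₁ 0) ⟩
      #dominating G₁ k * 1 + (1 * #dominating G₂ k + c)
        ≡⟨ cong₂ (λ x y → x + (y + c)) (*-identityʳ (#dominating G₁ k))
                                       (*-identityˡ (#dominating G₂ k)) ⟩
      #dominating G₁ k + (#dominating G₂ k + c)
        ≡⟨ +-assoc (#dominating G₁ k) (#dominating G₂ k) c ⟨
      #dominating G₁ k + #dominating G₂ k + c ∎
      where
      open ≡-Reasoning
      c : ℕ
      c = count (straddling? n₁ n₂ k) L
      left⊥right∪straddling : OnlyLeft ⊥ (OnlyRight ∪ Straddling n₁ n₂ k)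
      left⊥right∪straddling (((_ , ∣A∣≡k) , _) , inj₁ (∣A∣≡0 , _)) =
        n>0⇒n≢0 k>0 (trans (sym ∣A∣≡k) ∣A∣≡0)
      left⊥right∪straddling ((_ , ∣B∣≡0) , inj₂ ((_ , neB) , _)) =
        n>0⇒n≢0 (Nonempty⇒∣p∣>0 neB) ∣B∣≡0
      right⊥straddling : OnlyRight ⊥ Straddling n₁ n₂ k
      right⊥straddling ((∣A∣≡0 , _) , ((neA , _) , _)) =
        n>0⇒n≢0 (Nonempty⇒∣p∣>0 neA) ∣A∣≡0

  #dominating-∨-1 : #dominating J 1 ≡ #dominating G₁ 1 + #dominating G₂ 1
  #dominating-∨-1 = trans (#dominating-∨ (s≤s z≤n))
    (trans (cong (#dominating G₁ 1 + #dominating G₂ 1 +_) (count-straddling-1 n₁ n₂)) (+-identityʳ _))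

  #dominating-∨-2 : #dominating J 2 ≡ #dominating G₁ 2 + #dominating G₂ 2 + n₁ * n₂
  #dominating-∨-2 = trans (#dominating-∨ (s≤s z≤n))
    (cong (#dominating G₁ 2 + #dominating G₂ 2 +_) (count-straddling-2 n₁ n₂))

  γ-∨≡1 : 0 < n₁ → γ G₁ ≡ 1 → γ J ≡ 1
  γ-∨≡1 n₁>0 γ₁≡1 = γ≡least J #1>0 λ
    { 0 _ → #dominating-0 J (≤-trans n₁>0 (m≤m+n n₁ n₂))
    ; (suc _) (s≤s ())
    }
    where
    open ≤-Reasoning
    #1>0 : 0 < #dominating J 1
    #1>0 = begin-strict
      0                                       <⟨ ζ>0 G₁ ⟩
      ζ G₁                                    ≡⟨ cong (#dominating G₁) γ₁≡1 ⟩
      #dominating G₁ 1                        ≤⟨ m≤m+n _ _ ⟩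
      #dominating G₁ 1 + #dominating G₂ 1     ≡⟨ #dominating-∨-1 ⟨
      #dominating J 1                         ∎

  γ-∨≡2 : 0 < n₁ → 0 < n₂ → 1 < γ G₁ → 1 < γ G₂ → γ J ≡ 2
  γ-∨≡2 n₁>0 n₂>0 1<γ₁ 1<γ₂ = γ≡least J #2>0 λ
    { 0 _ → #dominating-0 J (≤-trans n₁>0 (m≤m+n n₁ n₂))
    ; 1 _ → trans #dominating-∨-1 (cong₂ _+_ (#dominating-<γ G₁ 1<γ₁) (#dominating-<γ G₂ 1<γ₂))
    ; (suc (suc _)) (s≤s (s≤s ()))
    }
    where
    open ≤-Reasoning
    #2>0 : 0 < #dominating J 2
    #2>0 = begin-strict
      0                                                  <⟨ *-mono-< n₁>0 n₂>0 ⟩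
      n₁ * n₂                                            ≤⟨ m≤n+m _ _ ⟩
      #dominating G₁ 2 + #dominating G₂ 2 + n₁ * n₂     ≡⟨ #dominating-∨-2 ⟨
      #dominating J 2                                    ∎

  ζ-∨-γ≡1 : 0 < n₁ → γ G₁ ≡ 1 → ζ J ≡ #dominating G₁ 1 + #dominating G₂ 1
  ζ-∨-γ≡1 n₁>0 γ₁≡1 = trans (cong (#dominating J) (γ-∨≡1 n₁>0 γ₁≡1)) #dominating-∨-1

  ζ-∨-γ≡2 : 0 < n₁ → 0 < n₂ → 1 < γ G₁ → 1 < γ G₂ →
            ζ J ≡ #dominating G₁ 2 + #dominating G₂ 2 + n₁ * n₂
  ζ-∨-γ≡2 n₁>0 n₂>0 1<γ₁ 1<γ₂ =
    trans (cong (#dominating J) (γ-∨≡2 n₁>0 n₂>0 1<γ₁ 1<γ₂)) #dominating-∨-2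

theorem3p3 : (G₁ G₂ : Graph) → Connected G₁ → Connected G₂ → γ G₁ ≤ γ G₂ →
    ((γ G₁ ≡ 1 → γ (G₁ ∨ G₂) ≡ 1)
    × (2 ≤ γ G₁ → γ (G₁ ∨ G₂) ≡ 2)
    × (γ G₁ ≡ 1 → γ G₂ ≡ 1 → ζ (G₁ ∨ G₂) ≡ ζ G₁ + ζ G₂)
    × (γ G₁ ≡ 2 → γ G₂ ≡ 2 → ζ (G₁ ∨ G₂) ≡ ζ G₁ + ζ G₂ + order G₁ * order G₂)
    × (γ G₁ ≡ 1 → 1 < γ G₂ → ζ (G₁ ∨ G₂) ≡ ζ G₁)
    × (γ G₁ ≡ 2 → 2 < γ G₂ → ζ (G₁ ∨ G₂) ≡ ζ G₁ + order G₁ * order G₂)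
    × (2 < γ G₁ → γ G₁ ≤ γ G₂ → ζ (G₁ ∨ G₂) ≡ order G₁ * order G₂))
theorem3p3 G₁ G₂ (n₁>0 , _) (n₂>0 , _) γ₁≤γ₂ =
    γ-∨≡1 n₁>0
  , γ-∨≡2′
  , (λ γ₁≡1 γ₂≡1 → trans (ζ-∨-γ≡1 n₁>0 γ₁≡1)
      (cong₂ _+_ (#dominating≡ζ G₁ γ₁≡1) (#dominating≡ζ G₂ γ₂≡1)))
  , (λ γ₁≡2 γ₂≡2 → trans (ζ-∨-γ≡2′ (≤-reflexive (sym γ₁≡2)))
      (cong₂ (λ x y → x + y + N) (#dominating≡ζ G₁ γ₁≡2) (#dominating≡ζ G₂ γ₂≡2)))
  , (λ γ₁≡1 1<γ₂ → trans (ζ-∨-γ≡1 n₁>0 γ₁≡1)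
      (trans (cong₂ _+_ (#dominating≡ζ G₁ γ₁≡1) (#dominating-<γ G₂ 1<γ₂)) (+-identityʳ (ζ G₁))))
  , (λ γ₁≡2 2<γ₂ → trans (ζ-∨-γ≡2′ (≤-reflexive (sym γ₁≡2)))
      (trans (cong₂ (λ x y → x + y + N) (#dominating≡ζ G₁ γ₁≡2) (#dominating-<γ G₂ 2<γ₂))
             (cong (_+ N) (+-identityʳ (ζ G₁)))))
  , (λ 2<γ₁ _ → trans (ζ-∨-γ≡2′ (<⇒≤ 2<γ₁))
      (cong₂ (λ x y → x + y + N) (#dominating-<γ G₁ 2<γ₁)
                                 (#dominating-<γ G₂ (<-≤-trans 2<γ₁ γ₁≤γ₂))))
  where
  open Join G₁ G₂
  N : ℕ
  N = order G₁ * order G₂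
  #dominating≡ζ : ∀ G {k} → γ G ≡ k → #dominating G k ≡ ζ G
  #dominating≡ζ G γ≡k = cong (#dominating G) (sym γ≡k)
  γ-∨≡2′ : 1 < γ G₁ → γ (G₁ ∨ G₂) ≡ 2
  γ-∨≡2′ 1<γ₁ = γ-∨≡2 n₁>0 n₂>0 1<γ₁ (≤-trans 1<γ₁ γ₁≤γ₂)
  ζ-∨-γ≡2′ : 1 < γ G₁ → ζ (G₁ ∨ G₂) ≡ #dominating G₁ 2 + #dominating G₂ 2 + N
  ζ-∨-γ≡2′ 1<γ₁ = ζ-∨-γ≡2 n₁>0 n₂>0 1<γ₁ (≤-trans 1<γ₁ γ₁≤γ₂)
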